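{- Let $G=(V,E)$ be a graph, fix integers $c\ge2$ and $\ell\ge1$, let ${\bf s}_G$ be the string associated to $G,c,\ell$ as in the context, and let $\varphi$ be an LZ-parsing of ${\bf s}_G$. Let $x_1<x_2<\dots<x_z$ be positions in the prefix $\alpha^{(1)}$ of ${\bf s}_G$ such that $hop(x_j)\ge2$ for each $j$ (hop-numbers with respect to $\varphi$), and such that there are pairwise distinct indices $i_1,\dots,i_z$ with $x_j$ lying in the substring $Y_{i_j}$ of $\alpha^{(1)}$. For $\gamma=1,\dots,\ell$ and $j=1,\dots,z$, let $x_j^\gamma=x_j+o_\gamma$ be the position in $\alpha^{(1)}_\gamma$ corresponding to $x_j$, where $o_\gamma$ is the offset of the start of $\alpha^{(1)}_\gamma$ relative to the start of ${\bf s}_G$, and let $x_{z+1}^\gamma$ be the unique position of the symbol $\#^{(1)}_\gamma$. If there exists $j\in\{1,\dots,z\}$ such that, for every $\gamma=1,\dots,\ell$, no phrase of $\varphi$ ends at a position in $\{x_j^\gamma,\dots,x_{j+1}^\gamma-1\}$, then for every $\gamma=1,\dots,\ell$ the substring $\alpha^{(1)}_\gamma$ contains a position $x$ with $hop(x)\ge3$.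
   Context: Strings: for ${\bf s}=s_1\dots s_N$, ${\bf s}[i,j]=s_i\dots s_j$. A parsing of ${\bf s}$ is a partition into consecutive nonempty substrings (phrases). An LZ-parsing is a parsing in which every phrase ${\bf s}[a,e]$ either has length $1$, or is given together with a chosen source start $b$ with $1\le b\le a-1$ and ${\bf s}[b,b+(e-a)-1]={\bf s}[a,e-1]$ (overlap allowed); each position $a+t$, $0\le t\le e-a-1$, then has source position $b+(t\bmod(a-b))$. The hop-number of position $p$ is $0$ if $p$ is the last position of a phrase and $hop(q)+1$ otherwise, where $q$ is the source position of $p$. Construction: $G$ is simple undirected with $V=\{v_1,\dots,v_n\}$, $E=\{e_1,\dots,e_m\}$; for each edge $e_i$ fix an ordering $(v_p,v_q)$ of its endpoints. Use pairwise distinct symbols $v_i,v_i',\#^v_i$ ($i\in[n]$), $e_i,\$_i,\#^e_i$ ($i\in[m]$), $\#^p_t$ ($t\in[n+m]$), $\#^{(i)}_\gamma$ ($1\le i\le c-1$, $1\le\gamma\le\ell$). $P=v_1\#^p_1\cdots v_n\#^p_n e_1\#^p_{n+1}\cdots e_m\#^p_{n+m}$; $X_i=v_i'v_i\#^v_i$, $X=X_1\cdots X_n$; for $e_i=(v_p,v_q)$, $Y_i=v_p'\,v_p\,e_i\,\$_i\,v_q'\,v_q\,e_i\,\$_i\,\#^e_i$, $Y=Y_1\cdots Y_m$; $\alpha^{(1)}=PXY$; $\beta^{(i)}=\alpha^{(i)}\#^{(i)}_1\cdots\alpha^{(i)}\#^{(i)}_\ell$, $\alpha^{(i+1)}=\alpha^{(i)}\beta^{(i)}$;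 ${\bf s}_G=\alpha^{(c)}=\alpha^{(1)}\beta^{(1)}\cdots\beta^{(c-1)}$. For $1\le i\le c-1$ and $1\le\gamma\le\ell$, $\alpha^{(i)}_\gamma$ denotes the $\gamma$-th copy of $\alpha^{(i)}$ inside $\beta^{(i)}$, i.e. the substring of length $|\alpha^{(i)}|$ immediately preceding the unique occurrence of $\#^{(i)}_\gamma$. -}

module Defs where

open import Data.Nat using (ℕ; zero; suc; _+_; _*_; _∸_; _≤_; _<_)
open import Data.Nat.DivMod using (_%_)
open import Data.Fin using (Fin; toℕ) renaming (zero to fzero; suc to fsuc)
open import Data.List using (List; []; _∷_; _++_; concat; map; length; upTo; allFin; take)
open import Data.Maybe using (Maybe; just; nothing)
open import Data.Product using (Σ; _×_; _,_; proj₁; proj₂; ∃)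
open import Data.List.Membership.Propositional using (_∈_)
open import Relation.Binary.PropositionalEquality using (_≡_)
open import Relation.Nullary using (¬_)
open import Function using (_∘_)
open import Data.Sum using (_⊎_)

-- s at position i (1-indexed); nothing if out of range
at : {A : Set} → List A → ℕ → Maybe A
at []       _             = nothing
at (x ∷ xs) zero          = nothing
at (x ∷ xs) (suc zero)    = just x
at (x ∷ xs) (suc (suc i)) = at xs (suc i)

-- A phrase s[start,end]; source = nothing means no source (length-1 phrase),
-- source = just b means the chosen source start b.
record Phrase : Set where
  constructor phrase
  field
    start  : ℕ
    end    : ℕ
    source : Maybe ℕ
open Phrase public

data Covers (N : ℕ) : ℕ → List Phrase → Set where
  done : Covers N (suc N) []
  step : ∀ {a e src ps} → a ≤ e → Covers N (suc e) ps →
         Covers N a (phrase a e src ∷ ps)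

IsParsing : ℕ → List Phrase → Set
IsParsing N ps = Covers N 1 ps

data LZPhrase {A : Set} (s : List A) : Phrase → Set where
  single : ∀ {a} → LZPhrase s (phrase a a nothing)
  copy   : ∀ {a e b} → 1 ≤ b → b < a →
           (∀ t → t < e ∸ a → at s (b + t) ≡ at s (a + t)) →
           LZPhrase s (phrase a e (just b))

data AllLZ {A : Set} (s : List A) : List Phrase → Set where
  []  : AllLZ s []
  _∷_ : ∀ {p ps} → LZPhrase s p → AllLZ s ps → AllLZ s (p ∷ ps)

IsLZParsing : {A : Set} → List A → List Phrase → Set
IsLZParsing s φ = IsParsing (length s) φ × AllLZ s φ

-- t mod d (only used with d ≥ 1)
_mod_ : ℕ → ℕ → ℕ
t mod zero    = t
t mod (suc d) = t % suc d

EndsAt : List Phrase → ℕ → Set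
EndsAt φ p = Σ Phrase λ ph → ph ∈ φ × end ph ≡ p

-- Hop φ p h : the hop-number of position p w.r.t. φ is h.
-- Position a+t (0 ≤ t < e-a) of a phrase s[a,e] with source b has source
-- position b + (t mod (a-b)).
data Hop (φ : List Phrase) : ℕ → ℕ → Set where
  last : ∀ {p} → EndsAt φ p → Hop φ p 0
  step : ∀ {p a e b h} → phrase a e (just b) ∈ φ → a ≤ p → p < e →
         Hop φ (b + ((p ∸ a) mod (a ∸ b))) h → Hop φ p (suc h)

HopAtLeast : List Phrase → ℕ → ℕ → Set
HopAtLeast φ p k = Σ ℕ λ h → Hop φ p h × k ≤ h

-- Graphs: simple undirected graph on V = Fin n, E = Fin m, each edge given
-- with a fixed ordering (v_p , v_q) of its endpoints.

record Graph : Set where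
  field
    n m      : ℕ
    edge     : Fin m → Fin n × Fin n
    loopless : ∀ i → ¬ (proj₁ (edge i) ≡ proj₂ (edge i))
    distinct : ∀ i j → (edge i ≡ edge j
                        ⊎ (proj₁ (edge i) ≡ proj₂ (edge j) × proj₂ (edge i) ≡ proj₁ (edge j)))
               → i ≡ j

-- Symbols (pairwise distinct by constructor injectivity/disjointness).
-- Vertex/edge/P-separator indices are 0-based here (v k ↔ v_{k+1}, etc.);
-- hash i γ is #^{(i)}_γ with 1-based i and γ as in the paper.

data Sym : Set where
  v v' hv : ℕ → Sym          -- v_i , v_i' , #^v_i
  e dol he : ℕ → Sym         -- e_i , $_i , #^e_i
  hp : ℕ → Sym               -- #^p_t
  hash : ℕ → ℕ → Sym         -- #^{(i)}_γ

module Construction (G : Graph) (c ℓ : ℕ) where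
  open Graph G

  P : List Sym
  P = concat (map (λ k → v k ∷ hp k ∷ []) (upTo n))
      ++ concat (map (λ i → e i ∷ hp (n + i) ∷ []) (upTo m))

  X : List Sym
  X = concat (map (λ k → v' k ∷ v k ∷ hv k ∷ []) (upTo n))

  Y : Fin m → List Sym
  Y i = v' p ∷ v p ∷ e (toℕ i) ∷ dol (toℕ i) ∷
        v' q ∷ v q ∷ e (toℕ i) ∷ dol (toℕ i) ∷ he (toℕ i) ∷ []
    where
      p = toℕ (proj₁ (edge i))
      q = toℕ (proj₂ (edge i))

  Yall : List Sym
  Yall = concat (map Y (allFin m))

  α1 : List Sym
  α1 = P ++ X ++ Yall

  β : ℕ → List Sym → List Sym
  β i α = concat (map (λ γ → α ++ hash i (suc γ) ∷ []) (upTo ℓ))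

  -- α (k) = α^{(k+1)}
  α : ℕ → List Sym
  α zero    = α1
  α (suc k) = α k ++ β (suc k) (α k)

  sG : List Sym
  sG = α (c ∸ 1)

  yOff : Fin m → ℕ
  yOff i = length P + length X + length (concat (map Y (take (toℕ i) (allFin m))))

  InY : ℕ → Fin m → Set
  InY x i = yOff i < x × x ≤ yOff i + length (Y i)

  -- offset of α^{(1)}_γ (γ-th copy of α^{(1)} in β^{(1)}), 1 ≤ γ ≤ ℓ:
  -- s_G = α^{(1)} α^{(1)} #^{(1)}_1 α^{(1)} #^{(1)}_2 …
  o : ℕ → ℕ
  o γ = length α1 + (γ ∸ 1) * suc (length α1)

  -- the unique position of #^{(1)}_γ in s_G
  hashPos : ℕ → ℕ
  hashPos γ = o γ + length α1 + 1

-- next element of a sequence x_1 … x_z, with x_{z+1} := L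
nextPos : ∀ {z} → (Fin z → ℕ) → ℕ → Fin z → ℕ
nextPos {suc zero}    x L fzero    = L
nextPos {suc (suc z)} x L fzero    = x (fsuc fzero)
nextPos {suc (suc z)} x L (fsuc j) = nextPos (x ∘ fsuc) L j

{-# OPTIONS --safe #-}
-- Let x = x_j lie in Y_i, let h ≥ x be the position of #^e_i (the last symbol of Y_i) and L = h - x.
-- In the γ-th copy no phrase ends in [x + o_γ, h + o_γ], since x_{j+1}^γ lies beyond the copy of Y_i.
-- Hence x + o_γ lies in a copy phrase extending past h + o_γ; a copy phrase is periodic with period
-- the distance to its source, so the source q of x + o_γ has #^e_i at the earlier position q + L.
-- The only earlier occurrences of #^e_i are h and h + o_γ' with γ' < γ, so q is x or x + o_γ',
-- which have hop ≥ 2 by hypothesis or by induction on γ; hence hop(x + o_γ) ≥ 3.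
module Submission where

open import Defs hiding (e)
open import Data.Nat using (ℕ; zero; suc; _+_; _*_; _∸_; _⊓_; _≤_; _<_; z≤n; s≤s; _≤?_)
open import Data.Nat.Properties
open import Data.Nat.DivMod using (_/_; m≡m%n+[m/n]*n)
open import Data.Nat.Induction using (<-rec)
open import Data.Nat.Tactic.RingSolver using (solve-∀)
open import Data.Fin using (Fin; toℕ) renaming (zero to fzero; suc to fsuc; _<_ to _<ᶠ_)
open import Data.Fin.Properties using (toℕ<n; toℕ-injective) renaming (<-irrefl to <ᶠ-irrefl)
open import Data.List using (List; []; _∷_; _++_; concat; map; length; tabulate; applyUpTo; upTo; allFin; take)
open import Data.List.Properties using (length-++; length-take; length-tabulate; ++-identityʳ; ++-assoc)
open import Data.List.Membership.Propositional using (_∈_; _∉_)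
open import Data.List.Membership.Propositional.Properties using (∈-++⁻; ∈-concatMap⁻)
open import Data.List.Relation.Unary.Any using (here; there; satisfied)
open import Data.Maybe using (just)
open import Data.Product using (Σ; ∃-syntax; _×_; _,_; proj₁; proj₂)
open import Data.Sum using (_⊎_; inj₁; inj₂; [_,_]′)
open import Data.Empty using (⊥-elim)
open import Relation.Binary.PropositionalEquality
open import Relation.Nullary using (¬_; yes; no)
open import Function using (id; _∘_)

module _ {A : Set} where

  at-++ˡ : ∀ (xs : List A) {ys p} → p ≤ length xs → at (xs ++ ys) p ≡ at xs p
  at-++ˡ []       {[]}    {zero}        _         = refl
  at-++ˡ []       {_ ∷ _} {zero}        _         = refl
  at-++ˡ (x ∷ xs) {p = zero}            _         = refl
  at-++ˡ (x ∷ xs) {p = suc zero}        _         = refl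
  at-++ˡ (x ∷ xs) {p = suc (suc p)}     (s≤s p≤) = at-++ˡ xs p≤

  at-++ʳ : ∀ (xs : List A) {ys p} → 1 ≤ p → at (xs ++ ys) (length xs + p) ≡ at ys p
  at-++ʳ []       _ = refl
  at-++ʳ (x ∷ xs) {ys} {suc p} _ rewrite +-suc (length xs) p =
    trans (cong (at (xs ++ ys)) (sym (+-suc (length xs) p))) (at-++ʳ xs (s≤s z≤n))

  at-++⁻ : ∀ (xs : List A) {ys p v} → at (xs ++ ys) p ≡ just v →
           at xs p ≡ just v ⊎ ∃[ p′ ] p ≡ length xs + suc p′ × at ys (suc p′) ≡ just v
  at-++⁻ []       {[]}    {zero}        ()
  at-++⁻ []       {_ ∷ _} {zero}        ()
  at-++⁻ []       {p = suc p}       eq = inj₂ (p , refl , eq)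
  at-++⁻ (x ∷ xs) {p = suc zero}    eq = inj₁ eq
  at-++⁻ (x ∷ xs) {p = suc (suc p)} eq with at-++⁻ xs eq
  ... | inj₁ eq′               = inj₁ eq′
  ... | inj₂ (p′ , p≡ , eq′)  = inj₂ (p′ , cong suc p≡ , eq′)

  at-just⇒bounded : ∀ (xs : List A) {p v} → at xs p ≡ just v → 1 ≤ p × p ≤ length xs
  at-just⇒bounded (x ∷ xs) {suc zero}    _  = s≤s z≤n , s≤s z≤n
  at-just⇒bounded (x ∷ xs) {suc (suc p)} eq = s≤s z≤n , s≤s (proj₂ (at-just⇒bounded xs eq))

  at-just⇒∈ : ∀ (xs : List A) {p v} → at xs p ≡ just v → v ∈ xs
  at-just⇒∈ (x ∷ xs) {suc zero}    refl = here refl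
  at-just⇒∈ (x ∷ xs) {suc (suc p)} eq   = there (at-just⇒∈ xs eq)

  at-applyUpTo : ∀ (f : ℕ → A) {n t} → t < n → at (applyUpTo f n) (suc t) ≡ just (f t)
  at-applyUpTo f {suc n} {zero}  _          = refl
  at-applyUpTo f {suc n} {suc t} (s≤s t<n) = at-applyUpTo (f ∘ suc) t<n

  at-tabulate : ∀ {n} (f : Fin n → A) i → at (tabulate f) (suc (toℕ i)) ≡ just (f i)
  at-tabulate f fzero    = refl
  at-tabulate f (fsuc i) = at-tabulate (f ∘ fsuc) i

  at-tabulate⁻ : ∀ {n} (f : Fin n → A) {t y} → at (tabulate f) (suc t) ≡ just y →
                 ∃[ i ] toℕ i ≡ t × f i ≡ y
  at-tabulate⁻ {suc n} f {zero}  refl = fzero , refl , refl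
  at-tabulate⁻ {suc n} f {suc t} eq with at-tabulate⁻ (f ∘ fsuc) eq
  ... | i , refl , fi≡y = fsuc i , refl , fi≡y

module _ {A B : Set} (f : B → List A) {L : ℕ} (uniform : ∀ b → length (f b) ≡ L) where

  length-concat-uniform : ∀ bs → length (concat (map f bs)) ≡ length bs * L
  length-concat-uniform []       = refl
  length-concat-uniform (b ∷ bs) =
    trans (length-++ (f b)) (cong₂ _+_ (uniform b) (length-concat-uniform bs))

  at-concat-uniform : ∀ bs {b t r} → at bs (suc t) ≡ just b → 1 ≤ r → r ≤ L →
                      at (concat (map f bs)) (t * L + r) ≡ at (f b) r
  at-concat-uniform (b′ ∷ bs) {t = zero}  refl _ r≤L =
    at-++ˡ (f b′) (subst (_ ≤_) (sym (uniform b′)) r≤L)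
  at-concat-uniform (b′ ∷ bs) {b} {suc t} {r} eq 1≤r r≤L = begin
    at (f b′ ++ concat (map f bs)) (L + t * L + r)
      ≡⟨ cong (at (f b′ ++ concat (map f bs))) (trans (+-assoc L (t * L) r) (cong (_+ (t * L + r)) (sym (uniform b′)))) ⟩
    at (f b′ ++ concat (map f bs)) (length (f b′) + (t * L + r))
      ≡⟨ at-++ʳ (f b′) (≤-trans 1≤r (m≤n+m r (t * L))) ⟩
    at (concat (map f bs)) (t * L + r)
      ≡⟨ at-concat-uniform bs eq 1≤r r≤L ⟩
    at (f b) r ∎
    where open ≡-Reasoning

  at-concat-uniform⁻ : ∀ bs {p v} → at (concat (map f bs)) p ≡ just v →
    ∃[ t ] ∃[ r ] ∃[ b ] at bs (suc t) ≡ just b × p ≡ t * L + r × at (f b) r ≡ just v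
  at-concat-uniform⁻ (b ∷ bs) {p} eq with at-++⁻ (f b) eq
  ... | inj₁ eq′ = 0 , p , b , refl , refl , eq′
  ... | inj₂ (p′ , refl , eq′) with at-concat-uniform⁻ bs eq′
  ... | t , r , b′ , at≡ , p′≡ , eq″ =
    suc t , r , b′ , at≡ , trans (cong₂ _+_ (uniform b) p′≡) (sym (+-assoc L (t * L) r)) , eq″

∉-concatMap : ∀ {A B : Set} {y : B} (f : A → List B) → (∀ a → y ∉ f a) → ∀ as → y ∉ concat (map f as)
∉-concatMap f y∉f as y∈ = let a , y∈f = satisfied (∈-concatMap⁻ f {xs = as} y∈) in y∉f a y∈f

phrase-covering : ∀ {N a ps p} → Covers N a ps → a ≤ p → p ≤ N →
                  ∃[ ph ] ph ∈ ps × start ph ≤ p × p ≤ end ph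
phrase-covering done a≤p p≤N = ⊥-elim (<⇒≱ a≤p p≤N)
phrase-covering {p = p} (step {a} {e} {src} _ cv) a≤p p≤N with p ≤? e
... | yes p≤e = phrase a e src , here refl , a≤p , p≤e
... | no  p≰e with phrase-covering cv (≰⇒> p≰e) p≤N
... | ph , ph∈ , st , en = ph , there ph∈ , st , en

lz-phrase : ∀ {A : Set} {s : List A} {φ ph} → AllLZ s φ → ph ∈ φ → LZPhrase s ph
lz-phrase (lz ∷ _)   (here refl) = lz
lz-phrase (_  ∷ lzs) (there ph∈) = lz-phrase lzs ph∈

hopAtLeast-≤ : ∀ {φ p k k′} → k ≤ k′ → HopAtLeast φ p k′ → HopAtLeast φ p k
hopAtLeast-≤ k≤k′ (h , hop , k′≤h) = h , hop , ≤-trans k≤k′ k′≤h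

mod+multiple≡ : ∀ t {d} → 1 ≤ d → ∃[ k ] t mod d + k * d ≡ t
mod+multiple≡ t {suc d} _ = t / suc d , sym (m≡m%n+[m/n]*n t (suc d))

copy-periodic : ∀ {A : Set} {s : List A} {a e b} → b < a →
  (∀ t → t < e ∸ a → at s (b + t) ≡ at s (a + t)) →
  ∀ k t → b + (t + k * (a ∸ b)) < e → at s (b + t) ≡ at s (b + (t + k * (a ∸ b)))
copy-periodic {s = s} _ _ zero t _ = cong (at s) (cong (_ +_) (sym (+-identityʳ t)))
copy-periodic {s = s} {a} {e} {b} b<a same (suc k) t lt = begin
  at s (b + t)                       ≡⟨ copy-periodic {s = s} {a} {e} {b} b<a same k t (≤-<-trans shorter lt) ⟩
  at s (b + (t + k * d))             ≡⟨ same (t + k * d) (m+n≤o⇒m≤o∸n (suc (t + k * d)) in-phrase) ⟩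
  at s (a + (t + k * d))             ≡⟨ cong (at s) a+kd≡ ⟩
  at s (b + (t + suc k * d))         ∎
  where
  open ≡-Reasoning
  d = a ∸ b
  a+kd≡ : a + (t + k * d) ≡ b + (t + suc k * d)
  a+kd≡ = trans (cong (_+ (t + k * d)) (sym (m+[n∸m]≡n (<⇒≤ b<a)))) (regroup b d t k)
    where
    regroup : ∀ b d t k → b + d + (t + k * d) ≡ b + (t + (d + k * d))
    regroup = solve-∀
  shorter : b + (t + k * d) ≤ b + (t + suc k * d)
  shorter = +-monoʳ-≤ b (+-monoʳ-≤ t (m≤n+m (k * d) d))
  in-phrase : suc (t + k * d) + a ≤ e
  in-phrase = subst (λ w → suc w ≤ e) (trans (sym a+kd≡) (+-comm a _)) lt

copy-source-shift : ∀ {A : Set} {s : List A} {a e b p L} → LZPhrase s (phrase a e (just b)) →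
  a ≤ p → p + L < e →
  let q = b + ((p ∸ a) mod (a ∸ b)) in q + L < p + L × at s (q + L) ≡ at s (p + L)
copy-source-shift {s = s} {a} {e} {b} {p} {L} (copy _ b<a same) a≤p p+L<e =
  subst (_< p + L) q+L≡ (subst (b + (r + L) <_) (sym shift) (+-monoʳ-< b (m<m+n (r + L) (≤-trans d≥1 (m≤m+n d _))))) ,
  trans (cong (at s) (sym q+L≡))
        (trans (copy-periodic {s = s} {a} {e} {b} b<a same (suc k) (r + L) (subst (_< e) shift p+L<e))
               (cong (at s) (sym shift)))
  where
  d = a ∸ b
  d≥1 : 1 ≤ d
  d≥1 = m<n⇒0<n∸m b<a
  r = (p ∸ a) mod d
  k = proj₁ (mod+multiple≡ (p ∸ a) d≥1)
  q+L≡ : b + (r + L) ≡ b + r + L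
  q+L≡ = sym (+-assoc b r L)
  shift : p + L ≡ b + ((r + L) + suc k * d)
  shift = begin
    p + L                          ≡⟨ cong (_+ L) (sym (m+[n∸m]≡n a≤p)) ⟩
    a + (p ∸ a) + L                ≡⟨ cong₂ (λ u w → u + w + L) (sym (m+[n∸m]≡n (<⇒≤ b<a))) (sym (proj₂ (mod+multiple≡ (p ∸ a) d≥1))) ⟩
    b + d + (r + k * d) + L        ≡⟨ regroup b d r k L ⟩
    b + ((r + L) + suc k * d)      ∎
    where
    open ≡-Reasoning
    regroup : ∀ b d r k L → b + d + (r + k * d) + L ≡ b + ((r + L) + (d + k * d))
    regroup = solve-∀

hopAtLeast-suc : ∀ {A : Set} {s : List A} {φ p L k} → IsLZParsing s φ → 1 ≤ p → p + L ≤ length s →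
  (∀ p′ → p ≤ p′ → p′ ≤ p + L → ¬ EndsAt φ p′) →
  (∀ q → q + L < p + L → at s (q + L) ≡ at s (p + L) → HopAtLeast φ q k) →
  HopAtLeast φ p (suc k)
hopAtLeast-suc {s = s} {φ} {p} {L} {k} (covers , lz) 1≤p p+L≤ no-end earlier
  with phrase-covering covers 1≤p (≤-trans (m≤m+n p L) p+L≤)
... | ph , ph∈φ , a≤p , p≤e = from-phrase (lz-phrase lz ph∈φ) ph∈φ a≤p beyond
  where
  beyond : p + L < end ph
  beyond with end ph ≤? p + L
  ... | yes e≤ = ⊥-elim (no-end (end ph) p≤e e≤ (ph , ph∈φ , refl))
  ... | no  e≰ = ≰⇒> e≰
  from-phrase : ∀ {ph} → LZPhrase s ph → ph ∈ φ → start ph ≤ p → p + L < end ph → HopAtLeast φ p (suc k)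
  from-phrase single _ a≤p p+L<a = ⊥-elim (<⇒≱ p+L<a (≤-trans a≤p (m≤m+n p L)))
  from-phrase cp@(copy _ _ _) ph∈φ a≤p p+L<e with copy-source-shift {L = L} cp a≤p p+L<e
  ... | q+L< , same with earlier _ q+L< same
  ... | h , hop , k≤h = suc h , step ph∈φ a≤p (≤-<-trans (m≤m+n p L) p+L<e) hop , s≤s k≤h

nextPos-cases : ∀ {z} (f : Fin z → ℕ) L j → nextPos f L j ≡ L ⊎ ∃[ k ] j <ᶠ k × nextPos f L j ≡ f k
nextPos-cases {suc zero}    f L fzero    = inj₁ refl
nextPos-cases {suc (suc z)} f L fzero    = inj₂ (fsuc fzero , s≤s z≤n , refl)
nextPos-cases {suc (suc z)} f L (fsuc j) with nextPos-cases (f ∘ fsuc) L j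
... | inj₁ eq             = inj₁ eq
... | inj₂ (k , j<k , eq) = inj₂ (fsuc k , s≤s j<k , eq)

module Layout (G : Graph) (c ℓ : ℕ) where
  open Graph G
  open Construction G c ℓ

  -- α k is the paper's α^{(k+1)}, so α 1 = α^{(1)} β^{(1)} is the prefix of s_G holding every α^{(1)}_γ.

  N : ℕ
  N = length α1

  yEnd : Fin m → ℕ
  yEnd i = yOff i + 9

  length-Ys : ∀ js → length (concat (map Y js)) ≡ length js * 9
  length-Ys = length-concat-uniform Y (λ _ → refl)

  length-allFin : length (allFin m) ≡ m
  length-allFin = length-tabulate id

  yOff≡ : ∀ i → yOff i ≡ length P + length X + toℕ i * 9
  yOff≡ i = cong (length P + length X +_) (trans (length-Ys (take (toℕ i) (allFin m))) (cong (_* 9) length-prefix))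
    where
    length-prefix : length (take (toℕ i) (allFin m)) ≡ toℕ i
    length-prefix = trans (length-take (toℕ i) (allFin m))
                          (trans (cong (toℕ i ⊓_) length-allFin) (m≤n⇒m⊓n≡m (<⇒≤ (toℕ<n i))))

  yEnd≡ : ∀ i → yEnd i ≡ length P + (length X + (toℕ i * 9 + 9))
  yEnd≡ i = trans (cong (_+ 9) (yOff≡ i)) (regroup (length P) (length X) (toℕ i * 9))
    where
    regroup : ∀ x y z → x + y + z + 9 ≡ x + (y + (z + 9))
    regroup = solve-∀

  yEnd≤N : ∀ i → yEnd i ≤ N
  yEnd≤N i = subst₂ _≤_ (sym (yEnd≡ i)) (sym length-α1)
    (+-monoʳ-≤ (length P) (+-monoʳ-≤ (length X) (subst (_≤ m * 9) (+-comm 9 (toℕ i * 9)) (*-monoˡ-≤ 9 (toℕ<n i)))))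
    where
    length-α1 : N ≡ length P + (length X + m * 9)
    length-α1 = trans (length-++ P) (cong (length P +_) (trans (length-++ X)
                  (cong (length X +_) (trans (length-Ys (allFin m)) (cong (_* 9) length-allFin)))))

  InY-unique : ∀ {x i i′} → InY x i → InY x i′ → i ≡ i′
  InY-unique {x} {i} {i′} (i< , ≤i) (i′< , ≤i′) = toℕ-injective (≤-antisym (below i< ≤i′) (below i′< ≤i))
    where
    below : ∀ {a b} → yOff a < x → x ≤ yEnd b → toℕ a ≤ toℕ b
    below {a} {b} a<x x≤b = ≤-pred (*-cancelʳ-< 9 (toℕ a) (suc (toℕ b))
      (+-cancelˡ-< (length P + length X) _ _ (subst₂ _<_ (yOff≡ a) (trans (cong (_+ 9) (yOff≡ b)) (regroup _ (toℕ b * 9)))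
        (<-≤-trans a<x x≤b))))
      where
      regroup : ∀ u w → u + w + 9 ≡ u + (9 + w)
      regroup = solve-∀

  he∉P : ∀ {k} → he k ∉ P
  he∉P he∈ with ∈-++⁻ (concat (map (λ k → v k ∷ hp k ∷ []) (upTo n))) he∈
  ... | inj₁ he∈ˡ = ∉-concatMap _ (λ _ → λ { (here ()) ; (there (here ())) ; (there (there ())) }) (upTo n) he∈ˡ
  ... | inj₂ he∈ʳ = ∉-concatMap _ (λ _ → λ { (here ()) ; (there (here ())) ; (there (there ())) }) (upTo m) he∈ʳ

  he∉X : ∀ {k} → he k ∉ X
  he∉X = ∉-concatMap _ (λ _ → λ { (here ()) ; (there (here ())) ; (there (there (here ()))) ; (there (there (there ()))) }) (upTo n)

  at-Y-he : ∀ i {r k} → at (Y i) r ≡ just (he k) → r ≡ 9 × toℕ i ≡ k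
  at-Y-he i {9} refl = refl , refl
  at-Y-he i {suc (suc (suc (suc (suc (suc (suc (suc (suc (suc r)))))))))} ()

  α1-he : ∀ i → at α1 (yEnd i) ≡ just (he (toℕ i))
  α1-he i = begin
    at α1 (yEnd i)                                           ≡⟨ cong (at α1) (yEnd≡ i) ⟩
    at (P ++ X ++ Yall) (length P + (length X + (toℕ i * 9 + 9))) ≡⟨ at-++ʳ P (≤-trans 1≤tail (m≤n+m _ (length X))) ⟩
    at (X ++ Yall) (length X + (toℕ i * 9 + 9))              ≡⟨ at-++ʳ X 1≤tail ⟩
    at Yall (toℕ i * 9 + 9)                                  ≡⟨ at-concat-uniform Y (λ _ → refl) (allFin m) (at-tabulate id i) (s≤s z≤n) ≤-refl ⟩
    just (he (toℕ i))                                        ∎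
    where
    open ≡-Reasoning
    1≤tail : 1 ≤ toℕ i * 9 + 9
    1≤tail = ≤-trans (s≤s z≤n) (m≤n+m 9 _)

  α1-he⁻ : ∀ i {p} → at α1 p ≡ just (he (toℕ i)) → p ≡ yEnd i
  α1-he⁻ i eq with at-++⁻ P eq
  ... | inj₁ eqᴾ = ⊥-elim (he∉P (at-just⇒∈ P eqᴾ))
  ... | inj₂ (p₁ , refl , eq₁) with at-++⁻ X eq₁
  ... | inj₁ eqˣ = ⊥-elim (he∉X (at-just⇒∈ X eqˣ))
  ... | inj₂ (p₂ , p₁≡ , eq₂) with at-concat-uniform⁻ Y (λ _ → refl) (allFin m) eq₂
  ... | t , r , i′ , at≡ , p₂≡ , eqʸ with at-Y-he i′ {r} eqʸ | at-tabulate⁻ id at≡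
  ... | refl , i′≡i | i″ , refl , refl =
    trans (cong (length P +_) (trans p₁≡ (cong (length X +_) (trans p₂≡ (cong (λ t → t * 9 + 9) i′≡i)))))
          (sym (yEnd≡ i))

  copy-block : ℕ → List Sym
  copy-block γ = α1 ++ hash 1 (suc γ) ∷ []

  length-copy-block : ∀ γ → length (copy-block γ) ≡ suc N
  length-copy-block γ = trans (length-++ α1) (+-comm N 1)

  o-mono-≤ : ∀ {γ γ′} → γ ≤ γ′ → o γ ≤ o γ′
  o-mono-≤ γ≤γ′ = +-monoʳ-≤ N (*-monoˡ-≤ (suc N) (∸-monoˡ-≤ 1 γ≤γ′))

  at-α₂-copy : ∀ {γ r} → 1 ≤ γ → γ ≤ ℓ → 1 ≤ r → r ≤ N → at (α 1) (o γ + r) ≡ at α1 r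
  at-α₂-copy {suc γ} {r} _ γ<ℓ 1≤r r≤N = begin
    at (α1 ++ β 1 α1) (N + γ * suc N + r)   ≡⟨ cong (at (α 1)) (+-assoc N (γ * suc N) r) ⟩
    at (α1 ++ β 1 α1) (N + (γ * suc N + r)) ≡⟨ at-++ʳ α1 (≤-trans 1≤r (m≤n+m r _)) ⟩
    at (β 1 α1) (γ * suc N + r)             ≡⟨ at-concat-uniform copy-block length-copy-block (upTo ℓ) (at-applyUpTo id γ<ℓ) 1≤r (m≤n⇒m≤1+n r≤N) ⟩
    at (copy-block γ) r                     ≡⟨ at-++ˡ α1 r≤N ⟩
    at α1 r                                 ∎
    where open ≡-Reasoning

  α₂-copy-he : ∀ {γ} i → 1 ≤ γ → γ ≤ ℓ → at (α 1) (o γ + yEnd i) ≡ just (he (toℕ i))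
  α₂-copy-he i 1≤γ γ≤ℓ =
    trans (at-α₂-copy 1≤γ γ≤ℓ (≤-trans (s≤s z≤n) (m≤n+m 9 (yOff i))) (yEnd≤N i)) (α1-he i)

  α₂-he⁻ : ∀ i {p} → at (α 1) p ≡ just (he (toℕ i)) → p ≡ yEnd i ⊎ ∃[ γ ] p ≡ o (suc γ) + yEnd i
  α₂-he⁻ i eq with at-++⁻ α1 eq
  ... | inj₁ eq′ = inj₁ (α1-he⁻ i eq′)
  ... | inj₂ (p′ , refl , eq′) with at-concat-uniform⁻ copy-block length-copy-block (upTo ℓ) eq′
  ... | γ , r , _ , _ , p′≡ , eq″ with at-++⁻ α1 eq″
  ... | inj₁ eq‴            = inj₂ (γ , trans (cong (N +_) (trans p′≡ (cong (γ * suc N +_) (α1-he⁻ i eq‴))))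
                                              (sym (+-assoc N (γ * suc N) (yEnd i))))
  ... | inj₂ (zero  , _ , ())
  ... | inj₂ (suc _ , _ , ())

  α₂-prefix : ∀ k → ∃[ rest ] α (suc k) ≡ α 1 ++ rest
  α₂-prefix zero = [] , sym (++-identityʳ (α 1))
  α₂-prefix (suc k) with α₂-prefix k
  ... | rest , eq = rest ++ β (suc (suc k)) (α (suc k)) , trans (cong (_++ _) eq) (++-assoc (α 1) rest _)

  at-sG : 2 ≤ c → ∀ {p} → p ≤ length (α 1) → at sG p ≡ at (α 1) p
  at-sG 2≤c = at-α (m<n⇒0<n∸m 2≤c)
    where
    at-α : ∀ {k} → 1 ≤ k → ∀ {p} → p ≤ length (α 1) → at (α k) p ≡ at (α 1) p
    at-α {suc k} _ {p} p≤ with α₂-prefix k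
    ... | rest , eq = trans (cong (λ s → at s p) eq) (at-++ˡ (α 1) p≤)

  sG-copy-he : 2 ≤ c → ∀ {γ} i → 1 ≤ γ → γ ≤ ℓ → at sG (o γ + yEnd i) ≡ just (he (toℕ i))
  sG-copy-he 2≤c i 1≤γ γ≤ℓ =
    trans (at-sG 2≤c (proj₂ (at-just⇒bounded (α 1) he-at))) he-at
    where he-at = α₂-copy-he i 1≤γ γ≤ℓ

  sG-he-before-copy : 2 ≤ c → ∀ {γ q} i → 1 ≤ γ → γ ≤ ℓ → q < o γ + yEnd i →
    at sG q ≡ just (he (toℕ i)) → q ≡ yEnd i ⊎ ∃[ γ′ ] suc γ′ < γ × q ≡ o (suc γ′) + yEnd i
  sG-he-before-copy 2≤c {γ} {q} i 1≤γ γ≤ℓ q< eq = [ inj₁ , earlier-copy ]′ (α₂-he⁻ i eq′)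
    where
    bound : o γ + yEnd i ≤ length (α 1)
    bound = proj₂ (at-just⇒bounded (α 1) (α₂-copy-he i 1≤γ γ≤ℓ))
    eq′ : at (α 1) q ≡ just (he (toℕ i))
    eq′ = trans (sym (at-sG 2≤c (<⇒≤ (<-≤-trans q< bound)))) eq
    earlier-copy : ∃[ γ′ ] q ≡ o (suc γ′) + yEnd i → q ≡ yEnd i ⊎ ∃[ γ′ ] suc γ′ < γ × q ≡ o (suc γ′) + yEnd i
    earlier-copy (γ′ , q≡) =
      inj₂ (γ′ , ≰⇒> (λ γ≤γ′ → <⇒≱ q< (subst (o γ + yEnd i ≤_) (sym q≡) (+-monoˡ-≤ (yEnd i) (o-mono-≤ γ≤γ′)))) , q≡)

  hopAtLeast-3-in-copies : 2 ≤ c → ∀ {φ x i} → IsLZParsing sG φ → InY x i → HopAtLeast φ x 2 →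
    (∀ γ → 1 ≤ γ → γ ≤ ℓ → ∀ p → x + o γ ≤ p → p ≤ o γ + yEnd i → ¬ EndsAt φ p) →
    ∀ γ → 1 ≤ γ → γ ≤ ℓ → HopAtLeast φ (x + o γ) 3
  hopAtLeast-3-in-copies 2≤c {φ} {x} {i} lz (yOff<x , x≤yEnd) hop₂ no-end = <-rec _ hop₃
    where
    L = proj₁ (m≤n⇒∃[o]m+o≡n x≤yEnd)
    x+L≡ : x + L ≡ yEnd i
    x+L≡ = proj₂ (m≤n⇒∃[o]m+o≡n x≤yEnd)
    shifted : ∀ γ → x + o γ + L ≡ o γ + yEnd i
    shifted γ = trans (regroup x (o γ) L) (cong (o γ +_) x+L≡)
      where
      regroup : ∀ x y z → x + y + z ≡ y + (x + z)
      regroup = solve-∀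
    hop₃ : ∀ γ → (∀ {γ′} → γ′ < γ → 1 ≤ γ′ → γ′ ≤ ℓ → HopAtLeast φ (x + o γ′) 3) →
           1 ≤ γ → γ ≤ ℓ → HopAtLeast φ (x + o γ) 3
    hop₃ γ ih 1≤γ γ≤ℓ = hopAtLeast-suc lz (≤-trans (s≤s z≤n) (≤-trans yOff<x (m≤m+n x (o γ)))) in-range
      (λ p lo hi → no-end γ 1≤γ γ≤ℓ p lo (subst (p ≤_) (shifted γ) hi)) earlier
      where
      he-at = sG-copy-he 2≤c i 1≤γ γ≤ℓ
      in-range : x + o γ + L ≤ length sG
      in-range = subst (_≤ length sG) (sym (shifted γ)) (proj₂ (at-just⇒bounded sG he-at))
      earlier : ∀ q → q + L < x + o γ + L → at sG (q + L) ≡ at sG (x + o γ + L) → HopAtLeast φ q 2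
      earlier q q+L< same =
        [ (λ q+L≡ → subst (λ w → HopAtLeast φ w 2) (sym (+-cancelʳ-≡ L q x (trans q+L≡ (sym x+L≡)))) hop₂)
        , (λ { (γ′ , γ′<γ , q+L≡) →
             subst (λ w → HopAtLeast φ w 2) (sym (+-cancelʳ-≡ L q _ (trans q+L≡ (sym (shifted (suc γ′))))))
               (hopAtLeast-≤ (n≤1+n 2) (ih γ′<γ (s≤s z≤n) (≤-trans (<⇒≤ γ′<γ) γ≤ℓ))) })
        ]′ (sG-he-before-copy 2≤c i 1≤γ γ≤ℓ (subst (q + L <_) (shifted γ) q+L<)
              (trans same (trans (cong (at sG) (shifted γ)) he-at)))

  yEnd-before-next : ∀ {z} {x : Fin z → ℕ} {idx : Fin z → Fin m} →
    (∀ j k → j <ᶠ k → x j < x k) → (∀ j k → idx j ≡ idx k → j ≡ k) → (∀ j → InY (x j) (idx j)) →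
    ∀ j γ → o γ + yEnd (idx j) < nextPos (λ k → x k + o γ) (hashPos γ) j
  yEnd-before-next {x = x} {idx} mono inj iny j γ with nextPos-cases (λ k → x k + o γ) (hashPos γ) j
  ... | inj₁ eq = subst (o γ + yEnd (idx j) <_) (sym eq)
                    (subst (o γ + yEnd (idx j) <_) (+-comm 1 (o γ + N)) (s≤s (+-monoʳ-≤ (o γ) (yEnd≤N (idx j)))))
  ... | inj₂ (k , j<k , eq) = subst (o γ + yEnd (idx j) <_) (sym eq)
                                (subst (o γ + yEnd (idx j) <_) (+-comm (o γ) (x k)) (+-monoʳ-< (o γ) beyond))
    where
    beyond : yEnd (idx j) < x k
    beyond = ≰⇒> (λ x≤ → <ᶠ-irrefl (inj j k (InY-unique (<-trans (proj₁ (iny j)) (mono j k j<k) , x≤) (iny k))) j<k)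

lemma4 : (G : Graph) (c ℓ : ℕ) → 2 ≤ c → 1 ≤ ℓ →
  let open Graph G
      open Construction G c ℓ
  in (φ : List Phrase) → IsLZParsing sG φ →
     (z : ℕ) (x : Fin z → ℕ) (idx : Fin z → Fin m) →
     (∀ j k → j <ᶠ k → x j < x k) →
     (∀ j → HopAtLeast φ (x j) 2) →
     (∀ j k → idx j ≡ idx k → j ≡ k) →
     (∀ j → InY (x j) (idx j)) →
     (Σ (Fin z) λ j → (γ : ℕ) → 1 ≤ γ → γ ≤ ℓ →
        (p : ℕ) → x j + o γ ≤ p →
        p < nextPos (λ k → x k + o γ) (hashPos γ) j →
        ¬ EndsAt φ p) →
     (γ : ℕ) → 1 ≤ γ → γ ≤ ℓ →
     Σ ℕ λ p → o γ < p × p ≤ o γ + length α1 × HopAtLeast φ p 3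
lemma4 G c ℓ 2≤c _ φ lz z x idx mono hop₂ inj iny (j , no-end) γ 1≤γ γ≤ℓ =
  x j + o γ ,
  subst (o γ <_) (+-comm (o γ) (x j)) (m<m+n (o γ) (≤-trans (s≤s z≤n) (proj₁ (iny j)))) ,
  subst (_≤ o γ + N) (+-comm (o γ) (x j)) (+-monoʳ-≤ (o γ) (≤-trans (proj₂ (iny j)) (yEnd≤N (idx j)))) ,
  hopAtLeast-3-in-copies 2≤c {i = idx j} lz (iny j) (hop₂ j)
    (λ γ′ 1≤γ′ γ′≤ℓ p lo hi → no-end γ′ 1≤γ′ γ′≤ℓ p lo (≤-<-trans hi (yEnd-before-next mono inj iny j γ′)))
    γ 1≤γ γ≤ℓ
  where
  open Construction G c ℓ
  open Layout G c ℓ
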